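{- Let $\mathcal{A}$ be a $\sigma$-structure (function symbols possibly interpreted by partial functions), $I$ a set and $\mathcal{U}$ an ultrafilter over $I$. Every element of $A^I/\mathcal{U}$ has a representative in $\mathrm{rep}(\mathcal{A}^I)$ if and only if $\mathcal{U}$ is $\kappa^+$-complete, where $\kappa=|\overline{\mathrm{supp}}(\mathcal{A})|$.
   Context: The support $\mathrm{supp}(\mathcal{A})$ is the set of $a\in A$ such that for every function symbol $F$ of $\sigma$ (of arity $n$), every position $1\le p\le n$ and all $x_1,\dots,x_n\in A$, $F^{\mathcal{A}}$ is defined at the tuple obtained from $(x_1,\dots,x_n)$ by placing $a$ in position $p$. The anti-support is $\overline{\mathrm{supp}}(\mathcal{A})=A\setminus\mathrm{supp}(\mathcal{A})$. For $a\in A$, $\overline{a}$ is the constant function $I\to\{a\}$. $\mathrm{rep}(\mathcal{A}^I)=\{\overline{a}\mid a\in\overline{\mathrm{supp}}(\mathcal{A})\}\cup\{f\in A^I\mid f(j)\in\mathrm{supp}(\mathcal{A})\text{ for all }j\in I\}$. Elements of $A^I/\mathcal{U}$ are equivalence classes of functions $I\to A$ modulo agreement on a set in $\mathcal{U}$. An ultrafilter is $\mu$-complete if it is closed under intersections of fewer than $\mu$ of its members. -}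

module Defs where

open import Data.Nat using (ℕ)
open import Data.Fin using (Fin; _≟_)
open import Data.Maybe using (Maybe; Is-just)
open import Data.Product using (Σ; ∃; _×_; _,_)
open import Data.Sum using (_⊎_)
open import Data.Unit using (⊤)
open import Data.Empty using (⊥)
open import Relation.Nullary using (¬_; yes; no)
open import Relation.Binary.PropositionalEquality using (_≡_)
open import Function.Definitions using (Injective)

record Signature : Set₁ where
  field
    FunSym : Set
    funArity : FunSym → ℕ
    RelSym : Set
    relArity : RelSym → ℕ

record Structure (σ : Signature) : Set₁ where
  open Signature σ
  field
    Carrier : Set
    funInterp : (F : FunSym) → (Fin (funArity F) → Carrier) → Maybe Carrier
    relInterp : (R : RelSym) → (Fin (relArity R) → Carrier) → Set

place : {A : Set} {n : ℕ} → (Fin n → A) → Fin n → A → (Fin n → A)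
place xs p a q with p ≟ q
... | yes _ = a
... | no  _ = xs q

module _ {σ : Signature} (𝒜 : Structure σ) where
  open Signature σ
  open Structure 𝒜

  InSupp : Carrier → Set
  InSupp a = (F : FunSym) (p : Fin (funArity F)) (xs : Fin (funArity F) → Carrier)
             → Is-just (funInterp F (place xs p a))

  InAntiSupp : Carrier → Set
  InAntiSupp a = ¬ InSupp a

  InRep : {I : Set} → (I → Carrier) → Set
  InRep {I} g = (Σ Carrier λ a → InAntiSupp a × ((j : I) → g j ≡ a))
              ⊎ ((j : I) → InSupp (g j))

record IsUltrafilter {I : Set} (U : (I → Set) → Set) : Set₁ where
  field
    upward : {X Y : I → Set} → (∀ i → X i → Y i) → U X → U Y
    full : U (λ _ → ⊤)
    proper : ¬ U (λ _ → ⊥)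
    meet : {X Y : I → Set} → U X → U Y → U (λ i → X i × Y i)
    ultra : (X : I → Set) → U X ⊎ U (λ i → ¬ X i)

EveryClassHasRep : {σ : Signature} (𝒜 : Structure σ) (I : Set) (U : (I → Set) → Set) → Set
EveryClassHasRep 𝒜 I U = (f : I → Structure.Carrier 𝒜) →
  Σ (I → Structure.Carrier 𝒜) λ g → InRep 𝒜 g × U (λ i → f i ≡ g i)

-- U is κ⁺-complete with κ = |anti-supp(𝒜)|: U is closed under intersections of
-- families indexed by any J with |J| < κ⁺, i.e. |J| ≤ κ, i.e. J injects into anti-supp(𝒜).
AntiSuppPlusComplete : {σ : Signature} (𝒜 : Structure σ) (I : Set) (U : (I → Set) → Set) → Set₁
AntiSuppPlusComplete 𝒜 I U =
  (J : Set) (e : J → Structure.Carrier 𝒜) → (∀ j → InAntiSupp 𝒜 (e j)) → Injective _≡_ _≡_ e →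
  (X : J → I → Set) → (∀ j → U (X j)) → U (λ i → ∀ j → X j i)

{-# OPTIONS --safe #-}
module Submission where

open import Defs
open import Level using (0ℓ)
open import Axiom.ExcludedMiddle using (ExcludedMiddle)
open import Axiom.DoubleNegationElimination using (em⇒dne)
open import Function.Base using (_∘_)
open import Function.Bundles using (_⇔_; mk⇔)
open import Function.Definitions using (Injective)
open import Data.Product using (Σ; ∃; _×_; _,_)
open import Data.Sum using (inj₁; inj₂)
open import Data.Empty using (⊥-elim)
open import Data.Irrelevant using ([_])
open import Data.Refinement using (Refinement-syntax; _,_; value; value-injective)
open import Relation.Nullary using (¬_; Dec; yes; no)
open import Relation.Nullary.Recomputable using (¬-recompute)
open import Relation.Binary.PropositionalEquality using (_≡_; _≢_; refl; sym; trans; subst)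

-- A representative in rep(𝒜^I) of a map into the anti-support must be a
-- constant, so every map I → J with J injecting into the anti-support is
-- U-almost constant, and that already makes U closed under J-indexed
-- intersections. Conversely, if f is almost equal to no constant of the
-- anti-support, completeness puts f almost everywhere into the support, and f
-- patched outside the support is a representative.

module Ultrafilter (em : ExcludedMiddle 0ℓ) {I : Set} {U : (I → Set) → Set}
                   (isUltrafilter : IsUltrafilter U) where
  open IsUltrafilter isUltrafilter

  AlmostConstant : {J : Set} → (I → J) → Set
  AlmostConstant h = ∃ λ j → U (λ i → h i ≡ j)

  nonempty : {X : I → Set} → U X → ∃ X
  nonempty UX = em⇒dne em λ ∄X → proper (upward (λ i x → ∄X (i , x)) UX)

  ¬U⇒U∁ : {X : I → Set} → ¬ U X → U (λ i → ¬ X i)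
  ¬U⇒U∁ {X} ¬UX with ultra X
  ... | inj₁ UX  = ⊥-elim (¬UX UX)
  ... | inj₂ U∁X = U∁X

  almostConstant-injective : {J B : Set} {e : J → B} → Injective _≡_ _≡_ e →
                             (h : I → J) → AlmostConstant (e ∘ h) → AlmostConstant h
  almostConstant-injective e-inj h (b , Ueh≡b) with nonempty Ueh≡b
  ... | i₀ , eh₀≡b = h i₀ , upward (λ i eh≡b → e-inj (trans eh≡b (sym eh₀≡b))) Ueh≡b

  -- Send i to some j with i ∉ X j (to j₀ if there is none). Almost everywhere
  -- this is a fixed j*, and a point of X j* cannot be sent to j* by a failure.
  almostConstant⇒⋂-closed : {J : Set} → ((h : I → J) → AlmostConstant h) →
                            (X : J → I → Set) → (∀ j → U (X j)) → U (λ i → ∀ j → X j i)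
  almostConstant⇒⋂-closed {J} constant X UX with em {J}
  ... | no ∄j  = upward (λ i _ j → ⊥-elim (∄j j)) full
  ... | yes j₀ = ⋂-closed
    where
    failure : (i : I) → Dec (∃ λ j → ¬ X j i) → J
    failure i (yes (j , _)) = j
    failure i (no _)        = j₀

    inAll : (i : I) (d : Dec (∃ λ j → ¬ X j i)) {j* : J} → failure i d ≡ j* → X j* i → ∀ j → X j i
    inAll i (yes (j , ¬x)) refl x = ⊥-elim (¬x x)
    inAll i (no ∄j)        _    _ = λ j → em⇒dne em λ ¬x → ∄j (j , ¬x)

    ⋂-closed : U (λ i → ∀ j → X j i)
    ⋂-closed with constant (λ i → failure i em)
    ... | j* , Ufailure≡j* = upward (λ i (eq , x) → inAll i em eq x) (meet Ufailure≡j* (UX j*))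

module _ (em : ExcludedMiddle 0ℓ) {σ : Signature} (𝒜 : Structure σ) {I : Set} {U : (I → Set) → Set}
         (isUltrafilter : IsUltrafilter U) where
  open Structure 𝒜 renaming (Carrier to A)
  open IsUltrafilter isUltrafilter
  open Ultrafilter em isUltrafilter

  HasRep : (I → A) → Set
  HasRep f = Σ (I → A) λ g → InRep 𝒜 g × U (λ i → f i ≡ g i)

  -- The membership proof is irrelevant, so that value is injective.
  AntiSupp : Set
  AntiSupp = [ a ∈ A ∣ InAntiSupp 𝒜 a ]

  antiSupp : (a : AntiSupp) → InAntiSupp 𝒜 (value a)
  antiSupp (_ , [ ¬s ]) = ¬-recompute ¬s

  hasRep-antiSupp⇒almostConstant : (h : I → A) → (∀ i → InAntiSupp 𝒜 (h i)) → HasRep h → AlmostConstant h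
  hasRep-antiSupp⇒almostConstant h _ (g , inj₁ (a , _ , g≡a) , Uh≡g) =
    a , upward (λ i h≡g → trans h≡g (g≡a i)) Uh≡g
  hasRep-antiSupp⇒almostConstant h ¬supp (g , inj₂ supp , Uh≡g) =
    ⊥-elim (proper (upward (λ i h≡g → ¬supp i (subst (InSupp 𝒜) (sym h≡g) (supp i))) Uh≡g))

  everyClassHasRep⇒complete : EveryClassHasRep 𝒜 I U → AntiSuppPlusComplete 𝒜 I U
  everyClassHasRep⇒complete hasRep J e ¬supp e-inj = almostConstant⇒⋂-closed constant
    where
    constant : (h : I → J) → AlmostConstant h
    constant h = almostConstant-injective e-inj h
                   (hasRep-antiSupp⇒almostConstant (e ∘ h) (¬supp ∘ h) (hasRep (e ∘ h)))

  almostSupp⇒hasRep : (f : I → A) → U (λ i → InSupp 𝒜 (f i)) → HasRep f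
  almostSupp⇒hasRep f Usupp with nonempty Usupp
  ... | i₀ , supp₀ = (λ i → patch (f i) em) , inj₂ (λ i → patch-supp (f i) em)
                   , upward (λ i → patch-agrees (f i) em) Usupp
    where
    patch : (x : A) → Dec (InSupp 𝒜 x) → A
    patch x (yes _) = x
    patch x (no _)  = f i₀

    patch-supp : (x : A) (d : Dec (InSupp 𝒜 x)) → InSupp 𝒜 (patch x d)
    patch-supp x (yes s) = s
    patch-supp x (no _)  = supp₀

    patch-agrees : (x : A) (d : Dec (InSupp 𝒜 x)) → InSupp 𝒜 x → x ≡ patch x d
    patch-agrees x (yes _) _ = refl
    patch-agrees x (no ¬s) s = ⊥-elim (¬s s)

  avoidsAntiSupp⇒almostSupp : AntiSuppPlusComplete 𝒜 I U → (f : I → A) →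
                              (∀ a → InAntiSupp 𝒜 a → U (λ i → f i ≢ a)) → U (λ i → InSupp 𝒜 (f i))
  avoidsAntiSupp⇒almostSupp complete f avoids =
    upward (λ i f≢ → em⇒dne em λ ¬s → f≢ (f i , [ ¬s ]) refl)
           (complete AntiSupp value antiSupp value-injective (λ a i → f i ≢ value a)
                     (λ a → avoids (value a) (antiSupp a)))

  complete⇒everyClassHasRep : AntiSuppPlusComplete 𝒜 I U → EveryClassHasRep 𝒜 I U
  complete⇒everyClassHasRep complete f with em {∃ λ a → InAntiSupp 𝒜 a × U (λ i → f i ≡ a)}
  ... | yes (a , ¬s , Uf≡a) = (λ _ → a) , inj₁ (a , ¬s , λ _ → refl) , Uf≡a
  ... | no ¬const = almostSupp⇒hasRep f (avoidsAntiSupp⇒almostSupp complete f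
                      λ a ¬s → ¬U⇒U∁ λ Uf≡a → ¬const (a , ¬s , Uf≡a))

theorem4p28 : ExcludedMiddle 0ℓ → {σ : Signature} (𝒜 : Structure σ) (I : Set) (U : (I → Set) → Set)
    → IsUltrafilter U → (EveryClassHasRep 𝒜 I U ⇔ AntiSuppPlusComplete 𝒜 I U)
theorem4p28 em 𝒜 I U isUltrafilter =
  mk⇔ (everyClassHasRep⇒complete em 𝒜 isUltrafilter) (complete⇒everyClassHasRep em 𝒜 isUltrafilter)
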